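{- Let $H\in M_N(\pm1)$ be an Hadamard matrix (entries $\pm1$, rows pairwise orthogonal) of order $N\geq4$, and let $S_1,\dots,S_N$ be its row sums, $S_k=\sum_jH_{kj}$. (1) The numbers $S_1,\dots,S_N$ are all even, and they are all congruent to each other modulo $4$. (2) If $S_1,\dots,S_N$ are all $\equiv0\pmod 4$, then the number of indices $k$ with $S_k\equiv4\pmod 8$ is odd when $N\equiv4\pmod 8$, and even when $N\equiv0\pmod 8$. -}

module Defs where

open import Data.Nat using (ℕ; suc; zero)
open import Data.Fin using (Fin; _≟_)
open import Data.Integer using (ℤ; +_; -[1+_]; _+_; _*_; _-_)
open import Data.Integer.Divisibility using (_∣_)
open import Data.List using (List; filter; length)
open import Data.List.Base using (allFin)
open import Data.Sum using (_⊎_)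
open import Relation.Binary.PropositionalEquality using (_≡_; _≢_)
open import Relation.Nullary using (¬_; Dec)
open import Relation.Unary using (Decidable)
import Data.Nat.Divisibility as ℕD
open import Data.Integer using (∣_∣)

Matrix : ℕ → Set
Matrix N = Fin N → Fin N → ℤ

sumFin : (n : ℕ) → (Fin n → ℤ) → ℤ
sumFin zero    f = + 0
sumFin (suc n) f = f Fin.zero + sumFin n (λ j → f (Fin.suc j))

record IsHadamard (N : ℕ) (H : Matrix N) : Set where
  field
    entries    : ∀ i j → (H i j ≡ + 1) ⊎ (H i j ≡ -[1+ 0 ])
    orthogonal : ∀ i k → i ≢ k → sumFin N (λ j → H i j * H k j) ≡ + 0

rowSum : (N : ℕ) → Matrix N → Fin N → ℤ
rowSum N H k = sumFin N (H k)

_≡_[mod_] : ℤ → ℤ → ℤ → Set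
a ≡ b [mod m ] = m ∣ (a - b)

countFin : (N : ℕ) {P : Fin N → Set} → Decidable P → ℕ
countFin N P? = length (filter P? (allFin N))

-- decision procedure for  a ≡ b [mod + m]  (ℤ-divisibility is ℕ-divisibility of |a - b|)
congMod? : (m : ℕ) (a b : ℤ) → Dec (a ≡ b [mod + m ])
congMod? m a b = m ℕD.∣? ∣ a - b ∣

count4mod8 : (N : ℕ) → Matrix N → ℕ
count4mod8 N H = countFin N (λ k → congMod? 8 (rowSum N H k) (+ 4))

module Submission where

-- Every entry is odd, so for three distinct rows a, b, c each term (a_j + b_j)(a_j + c_j) is a
-- product of two even numbers; their sum is ⟨a,a⟩ + 0 + 0 + 0 = N, whence 4 ∣ N. Likewise
-- Σ_j (H_kj + 1) = S_k + N makes S_k even, and Σ_j (H_kj + 1)(H_lj + 1) = S_k + S_l + N for k ≠ l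
-- gives S_k ≡ -S_l ≡ S_l (mod 4). For (2), H Hᵀ = N I forces Hᵀ H = N I (the j-th column of
-- N I − Hᵀ H is annihilated by H and so has squared norm 0), hence Σ_k S_k² = N². When 4 ∣ S_k,
-- S_k² ≡ 16 or 0 (mod 32) according as S_k ≡ 4 or 0 (mod 8), and N² ≡ 16 or 0 (mod 32) according
-- as N ≡ 4 or 0 (mod 8); comparing modulo 32 gives the parity of the count.

open import Defs
open import Data.Nat using (ℕ; _≤_; _%_)
open import Data.Integer using (ℤ; +_)
open import Data.Product using (_×_)
open import Relation.Binary.PropositionalEquality using (_≡_)

import Data.Nat as ℕ
import Data.Nat.Properties as ℕ
import Data.Nat.Divisibility as ℕ
import Data.Nat.DivMod as ℕ
import Data.Integer as ℤ
import Data.Integer.Properties as ℤ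
open import Data.Integer using (0ℤ; 1ℤ; -1ℤ; -[1+_]; _+_; _*_; _-_; -_)
open import Data.Integer.Tactic.RingSolver using (solve-∀)
open import Algebra.Properties.Semiring.Sum ℤ.+-*-semiring
  using (sum-syntax; sum-cong-≗; sum-replicate-zero; ∑-distrib-+; ∑-comm; *-distribˡ-sum; *-distribʳ-sum)
open import Data.Empty using (⊥-elim)
open import Data.Fin using (Fin; zero; suc; _≟_)
open import Data.List using (filter; length; tabulate)
open import Data.Product using (_,_)
open import Data.Sum using (_⊎_; inj₁; inj₂)
open import Function using (_∘_; id)
open import Relation.Binary.PropositionalEquality using (refl; sym; trans; cong; cong₂; subst; _≢_; module ≡-Reasoning)
open import Relation.Nullary using (Dec; yes; no)
open import Relation.Unary using (Pred; Decidable)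
open ≡-Reasoning

sumFin≡∑ : ∀ n (f : Fin n → ℤ) → sumFin n f ≡ ∑[ i < n ] f i
sumFin≡∑ ℕ.zero    f = refl
sumFin≡∑ (ℕ.suc n) f = cong (_+_ (f zero)) (sumFin≡∑ n (f ∘ suc))

∑-const : ∀ n c → ∑[ i < n ] c ≡ + n * c
∑-const ℕ.zero    c = refl
∑-const (ℕ.suc n) c = trans (cong (_+_ c) (∑-const n c)) (sym (ℤ.suc-* (+ n) c))

∑-ones : ∀ n → ∑[ i < n ] 1ℤ ≡ + n
∑-ones n = trans (∑-const n 1ℤ) (ℤ.*-identityʳ (+ n))

∑-neg : ∀ {n} (f : Fin n → ℤ) → ∑[ i < n ] (- f i) ≡ - (∑[ i < n ] f i)
∑-neg f = begin
  ∑[ i < _ ] (- f i)     ≡⟨ sum-cong-≗ (λ i → sym (ℤ.-1*i≡-i (f i))) ⟩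
  ∑[ i < _ ] (-1ℤ * f i) ≡⟨ sym (*-distribˡ-sum -1ℤ f) ⟩
  -1ℤ * ∑[ i < _ ] f i   ≡⟨ ℤ.-1*i≡-i _ ⟩
  - (∑[ i < _ ] f i)     ∎

∑-distrib-- : ∀ {n} (f g : Fin n → ℤ) → ∑[ i < n ] (f i - g i) ≡ ∑[ i < n ] f i - ∑[ i < n ] g i
∑-distrib-- f g = trans (∑-distrib-+ f (-_ ∘ g)) (cong (_+_ (∑[ i < _ ] f i)) (∑-neg g))

∑-bilinear : ∀ {n} (a b c d : Fin n → ℤ) →
  ∑[ j < n ] ((a j + b j) * (c j + d j)) ≡
  (∑[ j < n ] (a j * c j) + ∑[ j < n ] (a j * d j)) + (∑[ j < n ] (b j * c j) + ∑[ j < n ] (b j * d j))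
∑-bilinear a b c d = begin
  ∑[ j < _ ] ((a j + b j) * (c j + d j))
    ≡⟨ sum-cong-≗ (λ j → expand (a j) (b j) (c j) (d j)) ⟩
  ∑[ j < _ ] ((a j * c j + a j * d j) + (b j * c j + b j * d j))
    ≡⟨ ∑-distrib-+ (λ j → a j * c j + a j * d j) (λ j → b j * c j + b j * d j) ⟩
  ∑[ j < _ ] (a j * c j + a j * d j) + ∑[ j < _ ] (b j * c j + b j * d j)
    ≡⟨ cong₂ _+_ (∑-distrib-+ (λ j → a j * c j) (λ j → a j * d j))
                 (∑-distrib-+ (λ j → b j * c j) (λ j → b j * d j)) ⟩
  (∑[ j < _ ] (a j * c j) + ∑[ j < _ ] (a j * d j)) + (∑[ j < _ ] (b j * c j) + ∑[ j < _ ] (b j * d j)) ∎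
  where
  expand : ∀ a b c d → (a + b) * (c + d) ≡ (a * c + a * d) + (b * c + b * d)
  expand = solve-∀

0≤i*i : ∀ i → 0ℤ ℤ.≤ i * i
0≤i*i (+ n)    = subst (0ℤ ℤ.≤_) (ℤ.pos-* n n) (ℤ.+≤+ ℕ.z≤n)
0≤i*i -[1+ n ] = ℤ.+≤+ ℕ.z≤n

∑-nonneg : ∀ {n} (f : Fin n → ℤ) → (∀ i → 0ℤ ℤ.≤ f i) → 0ℤ ℤ.≤ ∑[ i < n ] f i
∑-nonneg {ℕ.zero}  f _  = ℤ.+≤+ ℕ.z≤n
∑-nonneg {ℕ.suc n} f f≥0 = ℤ.+-mono-≤ (f≥0 zero) (∑-nonneg (f ∘ suc) (f≥0 ∘ suc))

nonneg-+≡0 : ∀ {i j} → 0ℤ ℤ.≤ i → 0ℤ ℤ.≤ j → i + j ≡ 0ℤ → i ≡ 0ℤ × j ≡ 0ℤ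
nonneg-+≡0 {+ m} {+ n} _ _ m+n≡0 =
  cong +_ (ℕ.m+n≡0⇒m≡0 m (ℤ.+-injective m+n≡0)) , cong +_ (ℕ.m+n≡0⇒n≡0 m (ℤ.+-injective m+n≡0))

nonneg-∑≡0 : ∀ {n} (f : Fin n → ℤ) → (∀ i → 0ℤ ℤ.≤ f i) → ∑[ i < n ] f i ≡ 0ℤ → ∀ i → f i ≡ 0ℤ
nonneg-∑≡0 {ℕ.suc n} f f≥0 ∑f≡0 i with nonneg-+≡0 (f≥0 zero) (∑-nonneg (f ∘ suc) (f≥0 ∘ suc)) ∑f≡0 | i
... | f₀≡0 , _       | zero   = f₀≡0
... | _    , ∑tail≡0 | suc i′ = nonneg-∑≡0 (f ∘ suc) (f≥0 ∘ suc) ∑tail≡0 i′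

∑-squares≡0 : ∀ {n} (f : Fin n → ℤ) → ∑[ i < n ] (f i * f i) ≡ 0ℤ → ∀ i → f i ≡ 0ℤ
∑-squares≡0 f ∑f²≡0 i with ℤ.i*j≡0⇒i≡0∨j≡0 (f i) (nonneg-∑≡0 (λ i → f i * f i) (0≤i*i ∘ f) ∑f²≡0 i)
... | inj₁ fi≡0 = fi≡0
... | inj₂ fi≡0 = fi≡0

δ : ∀ {n} → Fin n → Fin n → ℤ
δ zero    zero    = 1ℤ
δ zero    (suc _) = 0ℤ
δ (suc _) zero    = 0ℤ
δ (suc i) (suc j) = δ i j

δ-diag : ∀ {n} (i : Fin n) → δ i i ≡ 1ℤ
δ-diag zero    = refl
δ-diag (suc i) = δ-diag i

δ-off : ∀ {n} {i j : Fin n} → i ≢ j → δ i j ≡ 0ℤ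
δ-off {i = zero}  {zero}  i≢j = ⊥-elim (i≢j refl)
δ-off {i = zero}  {suc j} _   = refl
δ-off {i = suc i} {zero}  _   = refl
δ-off {i = suc i} {suc j} i≢j = δ-off (i≢j ∘ cong suc)

δ-sym : ∀ {n} (i j : Fin n) → δ i j ≡ δ j i
δ-sym zero    zero    = refl
δ-sym zero    (suc j) = refl
δ-sym (suc i) zero    = refl
δ-sym (suc i) (suc j) = δ-sym i j

∑-δ : ∀ {n} (j : Fin n) (f : Fin n → ℤ) → ∑[ i < n ] (δ i j * f i) ≡ f j
∑-δ {ℕ.suc n} zero    f = trans (cong₂ _+_ (ℤ.*-identityˡ (f zero)) (sum-replicate-zero n)) (ℤ.+-identityʳ (f zero))
∑-δ {ℕ.suc n} (suc j) f = trans (ℤ.+-identityˡ _) (∑-δ j (f ∘ suc))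

module ColumnGram {n : ℕ} (H : Fin n → Fin n → ℤ) where

  colGram : Fin n → Fin n → ℤ
  colGram i j = ∑[ k < n ] (H k i * H k j)

  ∑-*-colGram : ∀ (x : Fin n → ℤ) j →
    ∑[ i < n ] (x i * colGram i j) ≡ ∑[ k < n ] (H k j * ∑[ i < n ] (x i * H k i))
  ∑-*-colGram x j = begin
    ∑[ i < n ] (x i * colGram i j)                  ≡⟨ sum-cong-≗ (λ i → *-distribˡ-sum (x i) (λ k → H k i * H k j)) ⟩
    ∑[ i < n ] ∑[ k < n ] (x i * (H k i * H k j))   ≡⟨ ∑-comm (λ i k → x i * (H k i * H k j)) ⟩
    ∑[ k < n ] ∑[ i < n ] (x i * (H k i * H k j))   ≡⟨ sum-cong-≗ (λ k → sum-cong-≗ (λ i → rearrange (x i) (H k i) (H k j))) ⟩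
    ∑[ k < n ] ∑[ i < n ] (H k j * (x i * H k i))   ≡⟨ sum-cong-≗ (λ k → sym (*-distribˡ-sum (H k j) (λ i → x i * H k i))) ⟩
    ∑[ k < n ] (H k j * ∑[ i < n ] (x i * H k i))   ∎
    where
    rearrange : ∀ x h h′ → x * (h * h′) ≡ h′ * (x * h)
    rearrange = solve-∀

  ∑-rowSum² : ∀ N → (∀ i j → colGram i j ≡ N * δ i j) →
    ∑[ k < n ] (∑[ j < n ] H k j * ∑[ j < n ] H k j) ≡ + n * N
  ∑-rowSum² N colGram≡Nδ = begin
    ∑[ k < n ] (S k * S k)                          ≡⟨ sum-cong-≗ (λ k → square-expand k) ⟩
    ∑[ k < n ] ∑[ i < n ] ∑[ j < n ] (H k i * H k j) ≡⟨ ∑-comm (λ k i → ∑[ j < n ] (H k i * H k j)) ⟩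
    ∑[ i < n ] ∑[ k < n ] ∑[ j < n ] (H k i * H k j) ≡⟨ sum-cong-≗ (λ i → ∑-comm (λ k j → H k i * H k j)) ⟩
    ∑[ i < n ] ∑[ j < n ] colGram i j               ≡⟨ sum-cong-≗ (λ i → sum-cong-≗ {n} (λ j → trans (colGram≡Nδ i j) (ℤ.*-comm N (δ i j)))) ⟩
    ∑[ i < n ] ∑[ j < n ] (δ i j * N)               ≡⟨ sum-cong-≗ (λ i → sum-cong-≗ {n} (λ j → cong (_* N) (δ-sym i j))) ⟩
    ∑[ i < n ] ∑[ j < n ] (δ j i * N)               ≡⟨ sum-cong-≗ {n} (λ i → ∑-δ i (λ _ → N)) ⟩
    ∑[ i < n ] N                                    ≡⟨ ∑-const n N ⟩
    + n * N                                         ∎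
    where
    S : Fin n → ℤ
    S k = ∑[ j < n ] H k j
    square-expand : ∀ k → S k * S k ≡ ∑[ i < n ] ∑[ j < n ] (H k i * H k j)
    square-expand k = trans (*-distribʳ-sum (S k) (H k))
                            (sum-cong-≗ (λ i → *-distribˡ-sum (H k i) (H k)))

  module _ (N : ℤ) (rowGram≡Nδ : ∀ i k → ∑[ j < n ] (H i j * H k j) ≡ N * δ i k)
           (colGram-diag : ∀ j → colGram j j ≡ N) where

    defect : Fin n → Fin n → ℤ
    defect j i = N * δ i j - colGram i j

    ∑-*-defect : ∀ (x : Fin n → ℤ) j →
      ∑[ i < n ] (x i * defect j i) ≡ N * x j - ∑[ i < n ] (x i * colGram i j)
    ∑-*-defect x j = begin
      ∑[ i < n ] (x i * defect j i)
        ≡⟨ sum-cong-≗ (λ i → distrib N (x i) (δ i j) (colGram i j)) ⟩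
      ∑[ i < n ] (δ i j * (N * x i) - x i * colGram i j)
        ≡⟨ ∑-distrib-- (λ i → δ i j * (N * x i)) (λ i → x i * colGram i j) ⟩
      ∑[ i < n ] (δ i j * (N * x i)) - ∑[ i < n ] (x i * colGram i j)
        ≡⟨ cong (_- _) (∑-δ j (λ i → N * x i)) ⟩
      N * x j - ∑[ i < n ] (x i * colGram i j) ∎
      where
      distrib : ∀ N x d c → x * (N * d - c) ≡ d * (N * x) - x * c
      distrib = solve-∀

    H-annihilates-defect : ∀ j k → ∑[ i < n ] (H k i * defect j i) ≡ 0ℤ
    H-annihilates-defect j k = begin
      ∑[ i < n ] (H k i * defect j i)                      ≡⟨ ∑-*-defect (H k) j ⟩
      N * H k j - ∑[ i < n ] (H k i * colGram i j)         ≡⟨ cong (_-_ (N * H k j)) (∑-*-colGram (H k) j) ⟩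
      N * H k j - ∑[ l < n ] (H l j * ∑[ i < n ] (H k i * H l i))
        ≡⟨ cong (λ s → N * H k j - s) (sum-cong-≗ (λ l → cong (H l j *_) (rowGram≡Nδ k l))) ⟩
      N * H k j - ∑[ l < n ] (H l j * (N * δ k l))
        ≡⟨ cong (λ s → N * H k j - s) (sum-cong-≗ (λ l → trans (rearrange N (H l j) (δ k l)) (cong (_* (N * H l j)) (δ-sym k l)))) ⟩
      N * H k j - ∑[ l < n ] (δ l k * (N * H l j))         ≡⟨ cong (λ s → N * H k j - s) (∑-δ k (λ l → N * H l j)) ⟩
      N * H k j - N * H k j                                ≡⟨ ℤ.+-inverseʳ (N * H k j) ⟩
      0ℤ                                                   ∎
      where
      rearrange : ∀ N h d → h * (N * d) ≡ d * (N * h)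
      rearrange = solve-∀

    defect-norm : ∀ j → ∑[ i < n ] (defect j i * defect j i) ≡ 0ℤ
    defect-norm j = begin
      ∑[ i < n ] (defect j i * defect j i)
        ≡⟨ ∑-*-defect (defect j) j ⟩
      N * defect j j - ∑[ i < n ] (defect j i * colGram i j)
        ≡⟨ cong₂ (λ d s → N * d - s) diagonal (∑-*-colGram (defect j) j) ⟩
      N * 0ℤ - ∑[ k < n ] (H k j * ∑[ i < n ] (defect j i * H k i))
        ≡⟨ cong (λ s → N * 0ℤ - s) (sum-cong-≗ (λ k → cong (H k j *_) (annihilated k))) ⟩
      N * 0ℤ - ∑[ k < n ] (H k j * 0ℤ)
        ≡⟨ cong₂ _-_ (ℤ.*-zeroʳ N) (trans (sum-cong-≗ (λ k → ℤ.*-zeroʳ (H k j))) (sum-replicate-zero n)) ⟩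
      0ℤ ∎
      where
      diagonal : defect j j ≡ 0ℤ
      diagonal = begin
        N * δ j j - colGram j j ≡⟨ cong₂ (λ d c → N * d - c) (δ-diag j) (colGram-diag j) ⟩
        N * 1ℤ - N              ≡⟨ cong (_- N) (ℤ.*-identityʳ N) ⟩
        N - N                   ≡⟨ ℤ.+-inverseʳ N ⟩
        0ℤ                      ∎
      annihilated : ∀ k → ∑[ i < n ] (defect j i * H k i) ≡ 0ℤ
      annihilated k = trans (sum-cong-≗ (λ i → ℤ.*-comm (defect j i) (H k i))) (H-annihilates-defect j k)

    columns-orthogonal : ∀ i j → colGram i j ≡ N * δ i j
    columns-orthogonal i j = sym (ℤ.i-j≡0⇒i≡j _ _ (∑-squares≡0 (defect j) (defect-norm j) i))

indicator : ∀ {p} {P : Set p} → Dec P → ℤ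
indicator (yes _) = 1ℤ
indicator (no _)  = 0ℤ

count-tabulate : ∀ {a p n} {A : Set a} {P : Pred A p} (P? : Decidable P) (h : Fin n → A) →
  + length (filter P? (tabulate h)) ≡ ∑[ i < n ] indicator (P? (h i))
count-tabulate {n = ℕ.zero}  P? h = refl
count-tabulate {n = ℕ.suc n} P? h with P? (h zero)
... | yes _ = cong (_+_ 1ℤ) (count-tabulate P? (h ∘ suc))
... | no  _ = trans (count-tabulate P? (h ∘ suc)) (sym (ℤ.+-identityˡ _))

Is±1 : ℤ → Set
Is±1 x = x ≡ 1ℤ ⊎ x ≡ -1ℤ

±1-square : ∀ {x} → Is±1 x → x * x ≡ 1ℤ
±1-square (inj₁ refl) = refl
±1-square (inj₂ refl) = refl

±1-norm : ∀ {n} (v : Fin n → ℤ) → (∀ j → Is±1 (v j)) → ∑[ j < n ] (v j * v j) ≡ + n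
±1-norm {n} v v±1 = trans (sum-cong-≗ (λ j → ±1-square (v±1 j))) (∑-ones n)

-- Signed divisibility is opened only locally: the theorem is stated with the unsigned
-- Data.Integer.Divisibility._∣_.
module _ where
  open import Data.Integer.Divisibility.Signed
    using (_∣_; divides; ∣ᵤ⇒∣; ∣⇒∣ᵤ; ∣-trans; ∣m∣n⇒∣m+n; ∣m∣n⇒∣m-n; ∣m+n∣n⇒∣m; *-monoʳ-∣; *-monoˡ-∣; *-cancelˡ-∣)
  open import Data.Integer.DivMod using (a≡a%ℕn+[a/ℕn]*n; n%ℕd<d)
  open import Data.Integer using (_%ℕ_; _/ℕ_; ∣_∣)

  ∑-∣ : ∀ {n d} (f : Fin n → ℤ) → (∀ i → d ∣ f i) → d ∣ ∑[ i < n ] f i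
  ∑-∣ {ℕ.zero}  f _   = divides 0ℤ refl
  ∑-∣ {ℕ.suc n} f d∣f = ∣m∣n⇒∣m+n (d∣f zero) (∑-∣ (f ∘ suc) (d∣f ∘ suc))

  ∑-∣-difference : ∀ {n d} (f g : Fin n → ℤ) → (∀ i → d ∣ f i - g i) →
    d ∣ ∑[ i < n ] f i - ∑[ i < n ] g i
  ∑-∣-difference {d = d} f g d∣f-g = subst (d ∣_) (∑-distrib-- f g) (∑-∣ (λ i → f i - g i) d∣f-g)

  *-pres-∣ : ∀ {a b x y} → a ∣ x → b ∣ y → a * b ∣ x * y
  *-pres-∣ {a} {y = y} a∣x b∣y = ∣-trans (*-monoʳ-∣ a b∣y) (*-monoˡ-∣ y a∣x)

  ±1+±1-even : ∀ {x y} → Is±1 x → Is±1 y → + 2 ∣ x + y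
  ±1+±1-even (inj₁ refl) (inj₁ refl) = divides 1ℤ refl
  ±1+±1-even (inj₁ refl) (inj₂ refl) = divides 0ℤ refl
  ±1+±1-even (inj₂ refl) (inj₁ refl) = divides 0ℤ refl
  ±1+±1-even (inj₂ refl) (inj₂ refl) = divides -1ℤ refl

  ∣-sub-%ℕ : ∀ a d .{{_ : ℕ.NonZero d}} → + d ∣ a - + (a %ℕ d)
  ∣-sub-%ℕ a d = divides (a /ℕ d) (begin
    a - + (a %ℕ d)                              ≡⟨ cong (λ x → x - + (a %ℕ d)) (a≡a%ℕn+[a/ℕn]*n a d) ⟩
    + (a %ℕ d) + (a /ℕ d) * + d - + (a %ℕ d)    ≡⟨ cancel (+ (a %ℕ d)) (a /ℕ d) (+ d) ⟩
    (a /ℕ d) * + d                              ∎)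
    where
    cancel : ∀ r q d → r + q * d - r ≡ q * d
    cancel = solve-∀

  small-∣-difference⇒≡ : ∀ {d a b} → + d ∣ + a - + b → a ℕ.< d → b ℕ.< d → a ≡ b
  small-∣-difference⇒≡ {d} {a} {b} d∣a-b a<d b<d with ∣ + a - + b ∣ in eq | ∣⇒∣ᵤ d∣a-b
  ... | ℕ.zero  | _   = ℤ.+-injective (ℤ.i-j≡0⇒i≡j (+ a) (+ b) (ℤ.∣i∣≡0⇒i≡0 eq))
  ... | ℕ.suc _ | d∣ = ⊥-elim (ℕ.>⇒∤ (subst (ℕ._< d) eq ∣a-b∣<d) d∣)
    where
    ∣a-b∣<d : ∣ + a - + b ∣ ℕ.< d
    ∣a-b∣<d = ℕ.≤-<-trans (subst (ℕ._≤ a ℕ.⊔ b) (cong ∣_∣ (sym (ℤ.m-n≡m⊖n a b))) (ℤ.∣m⊝n∣≤m⊔n a b))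
                          (ℕ.⊔-pres-<m a<d b<d)

  %-unique : ∀ {d} .{{_ : ℕ.NonZero d}} {c r} → r ℕ.< d → + d ∣ + c - + r → c % d ≡ r
  %-unique {d} {c} {r} r<d d∣c-r =
    small-∣-difference⇒≡ (subst (+ d ∣_) (cancel (+ c) (+ r) (+ (c % d))) (∣m∣n⇒∣m-n d∣c-r (∣-sub-%ℕ (+ c) d)))
                       (ℕ.m%n<n c d) r<d
    where
    cancel : ∀ c r q → (c - r) - (c - q) ≡ q - r
    cancel = solve-∀

  ∣-square-difference : ∀ {s r} → + 8 ∣ s - r → + 2 ∣ r → + 32 ∣ s * s - r * r
  ∣-square-difference {s} {r} (divides v s-r≡8v) (divides w r≡2w) = divides (v * v * + 2 + v * w) (begin
    s * s - r * r                           ≡⟨ factor s r ⟩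
    (s - r) * ((s - r) + r + r)             ≡⟨ cong₂ (λ a b → a * (a + b + b)) s-r≡8v r≡2w ⟩
    v * + 8 * (v * + 8 + w * + 2 + w * + 2) ≡⟨ expand v w ⟩
    (v * v * + 2 + v * w) * + 32            ∎)
    where
    factor : ∀ s r → s * s - r * r ≡ (s - r) * ((s - r) + r + r)
    factor = solve-∀
    expand : ∀ v w → v * + 8 * (v * + 8 + w * + 2 + w * + 2) ≡ (v * v * + 2 + v * w) * + 32
    expand = solve-∀

  multiple-of-4-mod-8 : ∀ {s} → + 4 ∣ s → (+ 8 ∣ s) ⊎ (+ 8 ∣ s - + 4)
  multiple-of-4-mod-8 (divides u refl) with u %ℕ 2 | ∣-sub-%ℕ u 2 | n%ℕd<d u 2
  ... | 0 | 2∣u     | _ = inj₁ (*-monoˡ-∣ (+ 4) (subst (+ 2 ∣_) (ℤ.+-identityʳ u) 2∣u))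
  ... | 1 | 2∣u-1   | _ = inj₂ (subst (+ 8 ∣_) (shift u) (*-monoˡ-∣ (+ 4) 2∣u-1))
    where
    shift : ∀ u → (u - 1ℤ) * + 4 ≡ u * + 4 - + 4
    shift = solve-∀
  ... | ℕ.suc (ℕ.suc _) | _ | ℕ.s≤s (ℕ.s≤s ())

  square-mod-32 : ∀ {s} → + 4 ∣ s → + 32 ∣ s * s - + 16 * indicator (congMod? 8 s (+ 4))
  square-mod-32 {s} 4∣s with congMod? 8 s (+ 4)
  ... | yes s≡4 = ∣-square-difference {s} {+ 4} (∣ᵤ⇒∣ s≡4) (divides (+ 2) refl)
  ... | no  s≢4 with multiple-of-4-mod-8 4∣s
  ...   | inj₁ 8∣s   = ∣-square-difference {s} {0ℤ} (subst (+ 8 ∣_) (sym (ℤ.+-identityʳ s)) 8∣s) (divides 0ℤ refl)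
  ...   | inj₂ 8∣s-4 = ⊥-elim (s≢4 (∣⇒∣ᵤ 8∣s-4))

  ∣-sub-residue : ∀ {N d r} .{{_ : ℕ.NonZero d}} → N % d ≡ r → + d ∣ + N - + r
  ∣-sub-residue {N} {d} refl = ∣-sub-%ℕ (+ N) d

  square-mod-32-from-%8 : ∀ {N} t → t ℕ.< 2 → N % 8 ≡ 4 ℕ.* t → + 32 ∣ + N * + N - + 16 * + t
  square-mod-32-from-%8 {N} 0 _ N%8≡0 = ∣-square-difference {+ N} {0ℤ} (∣-sub-residue {N} {8} N%8≡0) (divides 0ℤ refl)
  square-mod-32-from-%8 {N} 1 _ N%8≡4 = ∣-square-difference {+ N} {+ 4} (∣-sub-residue {N} {8} N%8≡4) (divides (+ 2) refl)
  square-mod-32-from-%8 (ℕ.suc (ℕ.suc _)) (ℕ.s≤s (ℕ.s≤s ())) _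

  square-mod-32⇒%2 : ∀ {N c} t → t ℕ.< 2 → N % 8 ≡ 4 ℕ.* t → + 32 ∣ + N * + N - + 16 * + c → c % 2 ≡ t
  square-mod-32⇒%2 {N} {c} t t<2 N%8≡4t 32∣N²-16c = %-unique {c = c} t<2 (*-cancelˡ-∣ (+ 16) 32∣16[c-t])
    where
    factor : ∀ x c t → (x - + 16 * t) - (x - + 16 * c) ≡ + 16 * (c - t)
    factor = solve-∀
    32∣16[c-t] : + 32 ∣ + 16 * (+ c - + t)
    32∣16[c-t] = subst (+ 32 ∣_) (factor (+ N * + N) (+ c) (+ t))
                   (∣m∣n⇒∣m-n (square-mod-32-from-%8 {N} t t<2 N%8≡4t) 32∣N²-16c)

  module HadamardRows {N : ℕ} {H : Matrix N} (had : IsHadamard N H) where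
    open IsHadamard had
    open ColumnGram H

    S : Fin N → ℤ
    S = rowSum N H

    rowSum≡∑ : ∀ k → S k ≡ ∑[ j < N ] H k j
    rowSum≡∑ k = sumFin≡∑ N (H k)

    rows-orthogonal : ∀ {i k} → i ≢ k → ∑[ j < N ] (H i j * H k j) ≡ 0ℤ
    rows-orthogonal {i} {k} i≢k = trans (sym (sumFin≡∑ N (λ j → H i j * H k j))) (orthogonal i k i≢k)

    rowGram≡Nδ : ∀ i k → ∑[ j < N ] (H i j * H k j) ≡ + N * δ i k
    rowGram≡Nδ i k with i ≟ k
    ... | yes refl = trans (±1-norm (H i) (entries i)) (sym (trans (cong (_*_ (+ N)) (δ-diag i)) (ℤ.*-identityʳ (+ N))))
    ... | no  i≢k  = trans (rows-orthogonal i≢k) (sym (trans (cong (_*_ (+ N)) (δ-off i≢k)) (ℤ.*-zeroʳ (+ N))))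

    ∑rowSum²≡N² : ∑[ k < N ] (S k * S k) ≡ + N * + N
    ∑rowSum²≡N² = trans (sum-cong-≗ (λ k → cong₂ _*_ (rowSum≡∑ k) (rowSum≡∑ k)))
                    (∑-rowSum² (+ N) (columns-orthogonal (+ N) rowGram≡Nδ (λ j → ±1-norm (λ k → H k j) (λ k → entries k j))))

    three-rows⇒4∣N : ∀ {a b c} → a ≢ b → a ≢ c → b ≢ c → + 4 ∣ + N
    three-rows⇒4∣N {a} {b} {c} a≢b a≢c b≢c = subst (+ 4 ∣_) expansion
      (∑-∣ (λ j → (H a j + H b j) * (H a j + H c j))
           (λ j → *-pres-∣ (±1+±1-even (entries a j) (entries b j)) (±1+±1-even (entries a j) (entries c j))))
      where
      expansion : ∑[ j < N ] ((H a j + H b j) * (H a j + H c j)) ≡ + N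
      expansion = begin
        ∑[ j < N ] ((H a j + H b j) * (H a j + H c j))
          ≡⟨ ∑-bilinear (H a) (H b) (H a) (H c) ⟩
        (∑[ j < N ] (H a j * H a j) + ∑[ j < N ] (H a j * H c j)) + (∑[ j < N ] (H b j * H a j) + ∑[ j < N ] (H b j * H c j))
          ≡⟨ cong₂ _+_ (cong₂ _+_ (±1-norm (H a) (entries a)) (rows-orthogonal a≢c))
                       (cong₂ _+_ (rows-orthogonal (a≢b ∘ sym)) (rows-orthogonal b≢c)) ⟩
        + N + 0ℤ + 0ℤ
          ≡⟨ trans (ℤ.+-identityʳ _) (ℤ.+-identityʳ _) ⟩
        + N ∎

    rowSum+N-even : ∀ k → + 2 ∣ S k + + N
    rowSum+N-even k = subst (+ 2 ∣_) expansion (∑-∣ (λ j → H k j + 1ℤ) (λ j → ±1+±1-even (entries k j) (inj₁ refl)))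
      where
      expansion : ∑[ j < N ] (H k j + 1ℤ) ≡ S k + + N
      expansion = trans (∑-distrib-+ (H k) (λ _ → 1ℤ)) (cong₂ _+_ (sym (rowSum≡∑ k)) (∑-ones N))

    rowSum-even : + 4 ∣ + N → ∀ k → + 2 ∣ S k
    rowSum-even 4∣N k = ∣m+n∣n⇒∣m (rowSum+N-even k) (∣-trans (divides (+ 2) refl) 4∣N)

    4∣Sₖ+Sₗ+N : ∀ {k l} → k ≢ l → + 4 ∣ S k + S l + + N
    4∣Sₖ+Sₗ+N {k} {l} k≢l = subst (+ 4 ∣_) expansion
      (∑-∣ (λ j → (H k j + 1ℤ) * (H l j + 1ℤ))
           (λ j → *-pres-∣ (±1+±1-even (entries k j) (inj₁ refl)) (±1+±1-even (entries l j) (inj₁ refl))))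
      where
      expansion : ∑[ j < N ] ((H k j + 1ℤ) * (H l j + 1ℤ)) ≡ S k + S l + + N
      expansion = begin
        ∑[ j < N ] ((H k j + 1ℤ) * (H l j + 1ℤ))
          ≡⟨ ∑-bilinear (H k) (λ _ → 1ℤ) (H l) (λ _ → 1ℤ) ⟩
        (∑[ j < N ] (H k j * H l j) + ∑[ j < N ] (H k j * 1ℤ)) + (∑[ j < N ] (1ℤ * H l j) + ∑[ j < N ] 1ℤ)
          ≡⟨ cong₂ _+_ (cong₂ _+_ (rows-orthogonal k≢l) (trans (sum-cong-≗ (ℤ.*-identityʳ ∘ H k)) (sym (rowSum≡∑ k))))
                       (cong₂ _+_ (trans (sum-cong-≗ (ℤ.*-identityˡ ∘ H l)) (sym (rowSum≡∑ l))) (∑-ones N)) ⟩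
        0ℤ + S k + (S l + + N)
          ≡⟨ reassociate (S k) (S l) (+ N) ⟩
        S k + S l + + N ∎
        where
        reassociate : ∀ a b c → 0ℤ + a + (b + c) ≡ a + b + c
        reassociate = solve-∀

    rowSums-congruent : + 4 ∣ + N → ∀ k l → + 4 ∣ S k - S l
    rowSums-congruent 4∣N k l with k ≟ l
    ... | yes refl = divides 0ℤ (ℤ.+-inverseʳ (S k))
    ... | no  k≢l  = subst (+ 4 ∣_) (cancel (S k) (S l) (+ N))
                       (∣m∣n⇒∣m-n (4∣Sₖ+Sₗ+N k≢l) (∣m∣n⇒∣m+n (*-monoˡ-∣ (+ 2) (rowSum-even 4∣N l)) 4∣N))
      where
      cancel : ∀ a b n → a + b + n - (b * + 2 + n) ≡ a - b
      cancel = solve-∀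

    32∣N²-16·count4mod8 : (∀ k → + 4 ∣ S k) → + 32 ∣ + N * + N - + 16 * + count4mod8 N H
    32∣N²-16·count4mod8 4∣S = subst (+ 32 ∣_) (cong₂ _-_ ∑rowSum²≡N² ∑16·indicator≡16·count)
      (∑-∣-difference (λ k → S k * S k) (λ k → + 16 * indicator (P? k)) (λ k → square-mod-32 (4∣S k)))
      where
      P? : ∀ k → Dec (S k ≡ + 4 [mod + 8 ])
      P? k = congMod? 8 (S k) (+ 4)
      ∑16·indicator≡16·count : ∑[ k < N ] (+ 16 * indicator (P? k)) ≡ + 16 * + count4mod8 N H
      ∑16·indicator≡16·count = trans (sym (*-distribˡ-sum (+ 16) (indicator ∘ P?)))
                                     (cong (_*_ (+ 16)) (sym (count-tabulate P? id)))

    count4mod8-parity : (∀ k → + 4 ∣ S k) → ∀ t → t ℕ.< 2 → N % 8 ≡ 4 ℕ.* t → count4mod8 N H % 2 ≡ t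
    count4mod8-parity 4∣S t t<2 N%8≡4t = square-mod-32⇒%2 {N} {count4mod8 N H} t t<2 N%8≡4t (32∣N²-16·count4mod8 4∣S)

  3≤N⇒4∣N : ∀ {N H} → IsHadamard N H → 3 ℕ.≤ N → + 4 ∣ + N
  3≤N⇒4∣N had (ℕ.s≤s (ℕ.s≤s (ℕ.s≤s _))) =
    HadamardRows.three-rows⇒4∣N had {zero} {suc zero} {suc (suc zero)} (λ ()) (λ ()) (λ ())

open import Data.Integer.Divisibility using (_∣_)
import Data.Integer.Divisibility.Signed as Signed
open Signed using (∣⇒∣ᵤ; ∣ᵤ⇒∣)

lemma1p4 : (N : ℕ) → 4 ≤ N → (H : Matrix N) → IsHadamard N H →
    ((∀ k → + 2 ∣ rowSum N H k)
      × (∀ k l → rowSum N H k ≡ rowSum N H l [mod + 4 ]))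
    × ((∀ k → rowSum N H k ≡ + 0 [mod + 4 ]) →
       ((N % 8 ≡ 4 → count4mod8 N H % 2 ≡ 1)
        × (N % 8 ≡ 0 → count4mod8 N H % 2 ≡ 0)))
lemma1p4 N 4≤N H had =
    ((λ k → ∣⇒∣ᵤ (rowSum-even 4∣N k)) , (λ k l → ∣⇒∣ᵤ (rowSums-congruent 4∣N k l)))
  , λ S≡0 → count4mod8-parity (4∣rowSum S≡0) 1 (ℕ.n<1+n 1) , count4mod8-parity (4∣rowSum S≡0) 0 ℕ.z<s
  where
  open HadamardRows had
  4∣N : + 4 Signed.∣ + N
  4∣N = 3≤N⇒4∣N had (ℕ.<⇒≤ 4≤N)
  4∣rowSum : (∀ k → rowSum N H k ≡ + 0 [mod + 4 ]) → ∀ k → + 4 Signed.∣ rowSum N H k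
  4∣rowSum S≡0 k = subst (Signed._∣_ (+ 4)) (ℤ.+-identityʳ (rowSum N H k)) (∣ᵤ⇒∣ (S≡0 k))
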